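{- Let $\Phi$ be a finite reduced crystallographic root system in a Euclidean space $V$ with simple roots $\alpha_1,\dots,\alpha_r$, Weyl group $W$ generated by the simple reflections $s_1,\dots,s_r$, and let $I\subseteq\{1,\dots,r\}$. Let $V'=V\oplus\bigoplus_{p\in I}\mathbb{R}\beta_p$ and let $\hat s_i:V'\to V'$ be the linear map given by $\hat s_i(\alpha_j)=\alpha_j-\langle\alpha_j,\alpha_i^\vee\rangle\alpha_i$ and $\hat s_i(\beta_p)=\beta_p+\delta_{pi}\alpha_i$. Then the assignment $s_i\mapsto\hat s_i$ defines a well-defined action of $W$ on $V'$, i.e. it extends to a group homomorphism $W\to GL(V')$.
   Context: $\alpha^\vee=2\alpha/(\alpha,\alpha)$ and $\langle x,\alpha^\vee\rangle=2(x,\alpha)/(\alpha,\alpha)$ for the inner product $(\cdot,\cdot)$ of $V$.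
   Formalization: The Euclidean space V and the space V' are taken over the rationals rather than ℝ, with V given as ℚ^n carrying a rational inner product. -}

module Defs where

open import Data.Nat using (ℕ; zero; suc)
open import Data.Integer using (ℤ)
open import Data.Rational using (ℚ; 0ℚ; 1ℚ; _+_; _*_; _-_; -_; _<_; _÷_; ≢-nonZero; _/_)
open import Data.Rational.Properties using (_≟_)
open import Data.Fin using (Fin; zero; suc)
open import Data.Fin.Properties using () renaming (_≟_ to _≟ᶠ_)
open import Data.Vec using (Vec; []; _∷_; lookup; tabulate; map; zipWith; replicate)
open import Data.Vec.Membership.Propositional using (_∈_)
open import Data.List using (List; foldr)
open import Data.Product using (Σ; ∃; _×_; _,_)
open import Data.Sum using (_⊎_)
open import Function using (Injective)
open import Relation.Nullary using (¬_; yes; no)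
open import Relation.Binary.PropositionalEquality using (_≡_)

-- Vectors of ℚⁿ (the Euclidean space V, with coordinates in ℚ)
Vect : ℕ → Set
Vect n = Vec ℚ n

sumF : ∀ n → (Fin n → ℚ) → ℚ
sumF zero f = 0ℚ
sumF (suc n) f = f zero + sumF n (λ i → f (suc i))

_+ᵥ_ : ∀ {n} → Vect n → Vect n → Vect n
_+ᵥ_ = zipWith _+_

_·ᵥ_ : ∀ {n} → ℚ → Vect n → Vect n
c ·ᵥ v = map (c *_) v

0ᵥ : ∀ {n} → Vect n
0ᵥ = replicate _ 0ℚ

lincomb : ∀ {n m} → (Fin m → ℚ) → Vec (Vect n) m → Vect n
lincomb {n} {m} c vs = tabulate λ j → sumF m λ k → c k * lookup (lookup vs k) j

ℤ→ℚ : ℤ → ℚ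
ℤ→ℚ k = k / 1

record Euclidean (n : ℕ) : Set where
  field
    G       : Fin n → Fin n → ℚ
    symm    : ∀ i j → G i j ≡ G j i
  inner : Vect n → Vect n → ℚ
  inner x y = sumF n λ i → sumF n λ j → lookup x i * G i j * lookup y j
  field
    posdef  : ∀ (x : Vect n) → ¬ (x ≡ 0ᵥ) → 0ℚ < inner x x

module _ {n : ℕ} (E : Euclidean n) where
  open Euclidean E

  -- ⟨x, a^∨⟩ = 2 (x,a) / (a,a)   (set to 0 when a = 0, never used there)
  pairing : Vect n → Vect n → ℚ
  pairing x a with inner a a ≟ 0ℚ
  ... | yes _  = 0ℚ
  ... | no a≢0 = ((1ℚ + 1ℚ) * inner x a) ÷ inner a a
    where instance _ = ≢-nonZero a≢0

  reflect : Vect n → Vect n → Vect n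
  reflect a x = x +ᵥ ((- pairing x a) ·ᵥ a)

  record RootSystem : Set where
    field
      N        : ℕ
      Φ        : Vec (Vect n) N
      nonzero  : ∀ {a} → a ∈ Φ → ¬ (a ≡ 0ᵥ)
      spans    : ∀ (v : Vect n) → ∃ λ (c : Fin N → ℚ) → v ≡ lincomb c Φ
      closed   : ∀ {a b} → a ∈ Φ → b ∈ Φ → reflect a b ∈ Φ
      crystal  : ∀ {a b} → a ∈ Φ → b ∈ Φ → ∃ λ (k : ℤ) → pairing b a ≡ ℤ→ℚ k
      reduced  : ∀ {a} (c : ℚ) → a ∈ Φ → (c ·ᵥ a) ∈ Φ → (c ≡ 1ℚ) ⊎ (c ≡ - 1ℚ)

  record SimpleRoots (R : RootSystem) (r : ℕ) : Set where
    open RootSystem R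
    field
      α         : Vec (Vect n) r
      inΦ       : ∀ i → lookup α i ∈ Φ
      linIndep  : ∀ (c : Fin r → ℚ) → lincomb c α ≡ 0ᵥ → ∀ i → c i ≡ 0ℚ
      integral  : ∀ {b} → b ∈ Φ → ∃ λ (c : Fin r → ℤ) →
                    (b ≡ lincomb (λ i → ℤ→ℚ (c i)) α) ×
                    ((∀ i → Data.Integer._≤_ (Data.Integer.+ 0) (c i)) ⊎
                     (∀ i → Data.Integer._≤_ (c i) (Data.Integer.+ 0)))

    s : Fin r → Vect n → Vect n
    s i = reflect (lookup α i)

    actV : List (Fin r) → Vect n → Vect n
    actV w v = foldr s v w

    -- V' = V ⊕ ⨁_{p ∈ I} ℝβ_p, with I ⊆ {1..r} given by an injection ι : Fin k → Fin r,
    -- written in coordinates w.r.t. the basis (α₁,…,α_r, β_{ι 0},…,β_{ι (k-1)}).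
    V' : ℕ → Set
    V' k = Vec ℚ r × Vec ℚ k

    -- ŝ_i, the linear extension of ŝ_i(α_j) = α_j - ⟨α_j,α_i^∨⟩ α_i,
    -- ŝ_i(β_p) = β_p + δ_{pi} α_i
    ŝ : ∀ {k} → (Fin k → Fin r) → Fin r → V' k → V' k
    ŝ {k} ι i (x , c) = (tabulate λ m → lookup x m + coeff m) , c
      where
      δ : Fin r → Fin r → ℚ
      δ a b with a ≟ᶠ b
      ... | yes _ = 1ℚ
      ... | no _  = 0ℚ
      -- coefficient of α_m in Σ_j x_j (ŝ_i α_j - α_j) + Σ_q c_q (ŝ_i β_{ι q} - β_{ι q})
      coeff : Fin r → ℚ
      coeff m = δ m i * ( (sumF r λ j → lookup x j * (- pairing (lookup α j) (lookup α i)))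
                        + (sumF k λ q → lookup c q * δ (ι q) i))

    actV' : ∀ {k} → (Fin k → Fin r) → List (Fin r) → V' k → V' k
    actV' ι w v = foldr (ŝ ι) v w

{-# OPTIONS --safe #-}

-- Write X = Σⱼ xⱼ αⱼ for the α-part of (x , c) ∈ V′ and dᵢ(c) = Σ_{ι q = i} c_q (βshift).
-- Every ŝᵢ fixes c and acts on X by X ↦ sᵢ X + dᵢ(c) αᵢ. For a vector ω with
-- ⟨ω, αᵢ^∨⟩ = dᵢ(c) for all i one has sᵢ ω = ω − dᵢ(c) αᵢ, so X ↦ X − ω conjugates ŝᵢ into sᵢ,
-- and a word acting trivially on V acts trivially on V′.
-- Constructing ω would mean inverting the Cartan matrix; instead X is only observed through
-- the numbers (u, X), and the conjugation becomes the invariant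
--   (w·X, w z) = (X, z) + (ω, w z − z),
-- which needs only (ω, αₚ) = dₚ(c) (αₚ, αₚ)/2 and the α-coordinates of w z − z, accumulated
-- along the word. If w acts trivially then w z − z = 0, so (w·X, z) = (X, z) for all z.
module Submission where

open import Defs
open import Algebra.Bundles using (CommutativeRing)
open import Data.Empty using (⊥-elim)
open import Data.Fin using (Fin; zero; suc)
open import Data.Fin.Properties using () renaming (_≟_ to _≟ᶠ_)
open import Data.List using (List; []; _∷_)
open import Data.Nat using (ℕ; zero; suc)
open import Data.Product using (Σ-syntax; _,_; proj₁; proj₂)
open import Data.Rational using (ℚ; 0ℚ; 1ℚ; ½; _+_; _*_; _-_; -_; 1/_; NonZero; ≢-nonZero)
open import Data.Rational.Properties
open import Data.Rational.Solver using (module +-*-Solver)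
open import Data.Vec using (Vec; lookup; tabulate)
open import Data.Vec.Properties using (lookup∘tabulate; tabulate∘lookup; tabulate-cong; lookup-zipWith; lookup-map; ≡-dec)
open import Function using (_∘_; Injective)
open import Relation.Binary.PropositionalEquality
open import Relation.Nullary using (yes; no)
open import Algebra.Properties.Semiring.Sum (CommutativeRing.semiring +-*-commutativeRing)
  using (sum; sum-cong-≗; sum-replicate-zero; ∑-distrib-+; ∑-comm; *-distribˡ-sum; *-distribʳ-sum)
open import Algebra.Properties.Ring +-*-ring using (-1*x≈-x)
open import Algebra.Properties.Group +-0-group using (x∙y⁻¹≈ε⇒x≈y)

open +-*-Solver
open ≡-Reasoning

sumF≡sum : ∀ n (f : Fin n → ℚ) → sumF n f ≡ sum f
sumF≡sum zero    f = refl
sumF≡sum (suc n) f = cong (f zero +_) (sumF≡sum n (f ∘ suc))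

sumF-cong : ∀ n {f g : Fin n → ℚ} → (∀ i → f i ≡ g i) → sumF n f ≡ sumF n g
sumF-cong n {f} {g} f≗g = begin
  sumF n f  ≡⟨ sumF≡sum n f ⟩
  sum f     ≡⟨ sum-cong-≗ f≗g ⟩
  sum g     ≡⟨ sumF≡sum n g ⟨
  sumF n g  ∎

sumF-zero : ∀ n {f : Fin n → ℚ} → (∀ i → f i ≡ 0ℚ) → sumF n f ≡ 0ℚ
sumF-zero n f≗0 = trans (sumF-cong n f≗0) (trans (sumF≡sum n _) (sum-replicate-zero n))

sumF-distrib-+ : ∀ n (f g : Fin n → ℚ) → sumF n (λ i → f i + g i) ≡ sumF n f + sumF n g
sumF-distrib-+ n f g = begin
  sumF n (λ i → f i + g i)  ≡⟨ sumF≡sum n _ ⟩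
  sum (λ i → f i + g i)     ≡⟨ ∑-distrib-+ f g ⟩
  sum f + sum g             ≡⟨ cong₂ _+_ (sumF≡sum n f) (sumF≡sum n g) ⟨
  sumF n f + sumF n g       ∎

sumF-*ˡ : ∀ n a (f : Fin n → ℚ) → sumF n (λ i → a * f i) ≡ a * sumF n f
sumF-*ˡ n a f = begin
  sumF n (λ i → a * f i)  ≡⟨ sumF≡sum n _ ⟩
  sum (λ i → a * f i)     ≡⟨ *-distribˡ-sum a f ⟨
  a * sum f               ≡⟨ cong (a *_) (sumF≡sum n f) ⟨
  a * sumF n f            ∎

sumF-*ʳ : ∀ n a (f : Fin n → ℚ) → sumF n (λ i → f i * a) ≡ sumF n f * a
sumF-*ʳ n a f = begin
  sumF n (λ i → f i * a)  ≡⟨ sumF≡sum n _ ⟩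
  sum (λ i → f i * a)     ≡⟨ *-distribʳ-sum a f ⟨
  sum f * a               ≡⟨ cong (_* a) (sumF≡sum n f) ⟨
  sumF n f * a            ∎

sumF-neg : ∀ n (f : Fin n → ℚ) → sumF n (λ i → - f i) ≡ - sumF n f
sumF-neg n f = begin
  sumF n (λ i → - f i)       ≡⟨ sumF-cong n (λ i → -1*x≈-x (f i)) ⟨
  sumF n (λ i → - 1ℚ * f i)  ≡⟨ sumF-*ˡ n (- 1ℚ) f ⟩
  - 1ℚ * sumF n f            ≡⟨ -1*x≈-x (sumF n f) ⟩
  - sumF n f                 ∎

sumF-comm : ∀ m n (f : Fin m → Fin n → ℚ) →
            sumF m (λ i → sumF n (f i)) ≡ sumF n (λ j → sumF m (λ i → f i j))
sumF-comm m n f = begin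
  sumF m (λ i → sumF n (f i))            ≡⟨ sumF-cong m (λ i → sumF≡sum n (f i)) ⟩
  sumF m (λ i → sum (f i))               ≡⟨ sumF≡sum m _ ⟩
  sum (λ i → sum (f i))                  ≡⟨ ∑-comm f ⟩
  sum (λ j → sum (λ i → f i j))          ≡⟨ sumF≡sum n _ ⟨
  sumF n (λ j → sum (λ i → f i j))       ≡⟨ sumF-cong n (λ j → sumF≡sum m (λ i → f i j)) ⟨
  sumF n (λ j → sumF m (λ i → f i j))    ∎

δ : ∀ {n} → Fin n → Fin n → ℚ
δ a b with a ≟ᶠ b
... | yes _ = 1ℚ
... | no  _ = 0ℚ

δ-suc : ∀ {n} (a b : Fin n) → δ (suc a) (suc b) ≡ δ a b
δ-suc a b with a ≟ᶠ b
... | yes _ = refl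
... | no  _ = refl

sumF-δ : ∀ n i (f : Fin n → ℚ) → sumF n (λ m → δ m i * f m) ≡ f i
sumF-δ (suc n) zero f = begin
  1ℚ * f zero + sumF n (λ m → 0ℚ * f (suc m))
    ≡⟨ cong₂ _+_ (*-identityˡ (f zero)) (sumF-zero n (λ m → *-zeroˡ (f (suc m)))) ⟩
  f zero + 0ℚ                                  ≡⟨ +-identityʳ (f zero) ⟩
  f zero                                       ∎
sumF-δ (suc n) (suc i) f = begin
  0ℚ * f zero + sumF n (λ m → δ (suc m) (suc i) * f (suc m))
    ≡⟨ cong₂ _+_ (*-zeroˡ (f zero)) (sumF-cong n (λ m → cong (_* f (suc m)) (δ-suc m i))) ⟩
  0ℚ + sumF n (λ m → δ m i * f (suc m))                       ≡⟨ +-identityˡ _ ⟩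
  sumF n (λ m → δ m i * f (suc m))                            ≡⟨ sumF-δ n i (f ∘ suc) ⟩
  f (suc i)                                                   ∎

lookup-tabulate : ∀ {A : Set} {m} {f : Fin m → A} (v : Vec A m) → v ≡ tabulate f → ∀ i → lookup v i ≡ f i
lookup-tabulate _ refl = lookup∘tabulate _

lookup-extensionality : ∀ {A : Set} {m} {xs ys : Vec A m} → (∀ i → lookup xs i ≡ lookup ys i) → xs ≡ ys
lookup-extensionality {xs = xs} {ys} xs≗ys = begin
  xs                   ≡⟨ tabulate∘lookup xs ⟨
  tabulate (lookup xs) ≡⟨ tabulate-cong xs≗ys ⟩
  tabulate (lookup ys) ≡⟨ tabulate∘lookup ys ⟩
  ys                   ∎

dot : ∀ {r} → (Fin r → ℚ) → (Fin r → ℚ) → ℚ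
dot {r} x φ = sumF r (λ m → x m * φ m)

addAt : ∀ {r} → Fin r → ℚ → (Fin r → ℚ) → Fin r → ℚ
addAt i t x m = x m + δ m i * t

dot-congˡ : ∀ {r} {x y : Fin r → ℚ} φ → (∀ m → x m ≡ y m) → dot x φ ≡ dot y φ
dot-congˡ {r} φ x≗y = sumF-cong r (λ m → cong (_* φ m) (x≗y m))

dot-zeroˡ : ∀ {r} (φ : Fin r → ℚ) → dot (λ _ → 0ℚ) φ ≡ 0ℚ
dot-zeroˡ {r} φ = sumF-zero r (λ m → *-zeroˡ (φ m))

dot-addAt : ∀ {r} i t (x φ : Fin r → ℚ) → dot (addAt i t x) φ ≡ dot x φ + t * φ i
dot-addAt {r} i t x φ = begin
  sumF r (λ m → (x m + δ m i * t) * φ m)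
    ≡⟨ sumF-cong r (λ m → solve 4 (λ a d t b → (a :+ d :* t) :* b := a :* b :+ d :* (t :* b)) refl (x m) (δ m i) t (φ m)) ⟩
  sumF r (λ m → x m * φ m + δ m i * (t * φ m))      ≡⟨ sumF-distrib-+ r _ _ ⟩
  dot x φ + sumF r (λ m → δ m i * (t * φ m))        ≡⟨ cong (dot x φ +_) (sumF-δ r i (λ m → t * φ m)) ⟩
  dot x φ + t * φ i                                 ∎

dot-sub : ∀ {r} (x y φ : Fin r → ℚ) → dot (λ m → x m - y m) φ ≡ dot x φ - dot y φ
dot-sub {r} x y φ = begin
  sumF r (λ m → (x m - y m) * φ m)
    ≡⟨ sumF-cong r (λ m → solve 3 (λ a b c → (a :- b) :* c := a :* c :+ :- (b :* c)) refl (x m) (y m) (φ m)) ⟩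
  sumF r (λ m → x m * φ m + - (y m * φ m))    ≡⟨ sumF-distrib-+ r _ _ ⟩
  dot x φ + sumF r (λ m → - (y m * φ m))      ≡⟨ cong (dot x φ +_) (sumF-neg r _) ⟩
  dot x φ - dot y φ                           ∎

module _ {n : ℕ} (E : Euclidean n) where
  open Euclidean E

  G· : Vect n → Fin n → ℚ
  G· y i = sumF n (λ j → G i j * lookup y j)

  inner-G· : ∀ x y (f : Fin n → ℚ) → (∀ i → lookup x i ≡ f i) → inner x y ≡ sumF n (λ i → f i * G· y i)
  inner-G· x y f x≗f = sumF-cong n λ i → begin
    sumF n (λ j → lookup x i * G i j * lookup y j)    ≡⟨ sumF-cong n (λ j → *-assoc (lookup x i) (G i j) (lookup y j)) ⟩
    sumF n (λ j → lookup x i * (G i j * lookup y j))  ≡⟨ sumF-*ˡ n (lookup x i) _ ⟩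
    lookup x i * G· y i                               ≡⟨ cong (_* G· y i) (x≗f i) ⟩
    f i * G· y i                                      ∎

  inner-sym : ∀ x y → inner x y ≡ inner y x
  inner-sym x y = begin
    sumF n (λ i → sumF n (λ j → lookup x i * G i j * lookup y j))  ≡⟨ sumF-comm n n _ ⟩
    sumF n (λ j → sumF n (λ i → lookup x i * G i j * lookup y j))  ≡⟨ sumF-cong n (λ j → sumF-cong n (λ i → swap j i)) ⟩
    sumF n (λ j → sumF n (λ i → lookup y j * G j i * lookup x i))  ∎
    where
    swap : ∀ j i → lookup x i * G i j * lookup y j ≡ lookup y j * G j i * lookup x i
    swap j i rewrite symm i j = solve 3 (λ a g b → a :* g :* b := b :* g :* a) refl (lookup x i) (G j i) (lookup y j)

  inner-+ˡ : ∀ x y z → inner (x +ᵥ y) z ≡ inner x z + inner y z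
  inner-+ˡ x y z = begin
    inner (x +ᵥ y) z                                            ≡⟨ inner-G· (x +ᵥ y) z _ (λ i → lookup-zipWith _+_ i x y) ⟩
    sumF n (λ i → (lookup x i + lookup y i) * G· z i)           ≡⟨ sumF-cong n (λ i → *-distribʳ-+ (G· z i) (lookup x i) (lookup y i)) ⟩
    sumF n (λ i → lookup x i * G· z i + lookup y i * G· z i)    ≡⟨ sumF-distrib-+ n _ _ ⟩
    sumF n (λ i → lookup x i * G· z i) + sumF n (λ i → lookup y i * G· z i)
      ≡⟨ cong₂ _+_ (inner-G· x z (lookup x) (λ _ → refl)) (inner-G· y z (lookup y) (λ _ → refl)) ⟨
    inner x z + inner y z                                       ∎

  inner-*ˡ : ∀ c x z → inner (c ·ᵥ x) z ≡ c * inner x z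
  inner-*ˡ c x z = begin
    inner (c ·ᵥ x) z                            ≡⟨ inner-G· (c ·ᵥ x) z _ (λ i → lookup-map i (c *_) x) ⟩
    sumF n (λ i → c * lookup x i * G· z i)      ≡⟨ sumF-cong n (λ i → *-assoc c (lookup x i) (G· z i)) ⟩
    sumF n (λ i → c * (lookup x i * G· z i))    ≡⟨ sumF-*ˡ n c _ ⟩
    c * sumF n (λ i → lookup x i * G· z i)      ≡⟨ cong (c *_) (inner-G· x z (lookup x) (λ _ → refl)) ⟨
    c * inner x z                               ∎

  inner-lincombˡ : ∀ {m} (c : Fin m → ℚ) (vs : Vec (Vect n) m) z →
                   inner (lincomb c vs) z ≡ sumF m (λ k → c k * inner (lookup vs k) z)
  inner-lincombˡ {m} c vs z = begin
    inner (lincomb c vs) z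
      ≡⟨ inner-G· (lincomb c vs) z _ (λ i → lookup∘tabulate _ i) ⟩
    sumF n (λ i → sumF m (λ k → c k * v k i) * G· z i)
      ≡⟨ sumF-cong n (λ i → sumF-*ʳ m (G· z i) _) ⟨
    sumF n (λ i → sumF m (λ k → c k * v k i * G· z i))
      ≡⟨ sumF-comm n m _ ⟩
    sumF m (λ k → sumF n (λ i → c k * v k i * G· z i))
      ≡⟨ sumF-cong m (λ k → trans (sumF-cong n (λ i → *-assoc (c k) (v k i) (G· z i))) (sumF-*ˡ n (c k) _)) ⟩
    sumF m (λ k → c k * sumF n (λ i → v k i * G· z i))
      ≡⟨ sumF-cong m (λ k → cong (c k *_) (inner-G· (lookup vs k) z (lookup (lookup vs k)) (λ _ → refl))) ⟨
    sumF m (λ k → c k * inner (lookup vs k) z)  ∎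
    where
    v : Fin m → Fin n → ℚ
    v k i = lookup (lookup vs k) i

  inner-self-≢0 : ∀ {a} → a ≢ 0ᵥ → inner a a ≢ 0ℚ
  inner-self-≢0 {a} a≢0 aa≡0 = <-irrefl (sym aa≡0) (posdef a a≢0)

  inner-self≡0⇒≡0ᵥ : ∀ x → inner x x ≡ 0ℚ → x ≡ 0ᵥ
  inner-self≡0⇒≡0ᵥ x xx≡0 with ≡-dec _≟_ x 0ᵥ
  ... | yes x≡0 = x≡0
  ... | no  x≢0 = ⊥-elim (inner-self-≢0 x≢0 xx≡0)

  inner-self-*-pairing : ∀ x {a} → a ≢ 0ᵥ → inner a a * pairing E x a ≡ (1ℚ + 1ℚ) * inner x a
  inner-self-*-pairing x {a} a≢0 with inner a a ≟ 0ℚ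
  ... | yes aa≡0 = ⊥-elim (inner-self-≢0 a≢0 aa≡0)
  ... | no  aa≢0 = begin
    inner a a * (t * 1/ inner a a)    ≡⟨ solve 3 (λ N t k → N :* (t :* k) := (N :* k) :* t) refl (inner a a) t (1/ inner a a) ⟩
    inner a a * 1/ inner a a * t      ≡⟨ cong (_* t) (*-inverseʳ (inner a a)) ⟩
    1ℚ * t                            ≡⟨ *-identityˡ t ⟩
    t                                 ∎
    where
    instance
      aa-nonZero : NonZero (inner a a)
      aa-nonZero = ≢-nonZero aa≢0
    t : ℚ
    t = (1ℚ + 1ℚ) * inner x a

  pairing-*-inner-comm : ∀ x y a → pairing E x a * inner y a ≡ pairing E y a * inner x a
  pairing-*-inner-comm x y a with inner a a ≟ 0ℚ
  ... | yes _    = trans (*-zeroˡ (inner y a)) (sym (*-zeroˡ (inner x a)))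
  ... | no aa≢0  = solve 4 (λ t k u v → t :* u :* k :* v := t :* v :* k :* u) refl (1ℚ + 1ℚ) (1/ inner a a) (inner x a) (inner y a)
    where
    instance
      aa-nonZero : NonZero (inner a a)
      aa-nonZero = ≢-nonZero aa≢0

  ½-inner-self-*-pairing : ∀ y {a} → a ≢ 0ᵥ → ½ * inner a a * pairing E y a ≡ inner y a
  ½-inner-self-*-pairing y {a} a≢0 = begin
    ½ * inner a a * pairing E y a     ≡⟨ *-assoc ½ (inner a a) _ ⟩
    ½ * (inner a a * pairing E y a)   ≡⟨ cong (½ *_) (inner-self-*-pairing y a≢0) ⟩
    ½ * ((1ℚ + 1ℚ) * inner y a)       ≡⟨ *-assoc ½ (1ℚ + 1ℚ) (inner y a) ⟨
    1ℚ * inner y a                    ≡⟨ *-identityˡ (inner y a) ⟩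
    inner y a                         ∎

  inner-reflectˡ : ∀ a x y → inner (reflect E a x) y ≡ inner x y - pairing E x a * inner a y
  inner-reflectˡ a x y = begin
    inner (x +ᵥ ((- p) ·ᵥ a)) y          ≡⟨ inner-+ˡ x _ y ⟩
    inner x y + inner ((- p) ·ᵥ a) y     ≡⟨ cong (inner x y +_) (inner-*ˡ (- p) a y) ⟩
    inner x y + - p * inner a y          ≡⟨ cong (inner x y +_) (neg-distribˡ-* p (inner a y)) ⟨
    inner x y - p * inner a y            ∎
    where
    p : ℚ
    p = pairing E x a

  inner-reflectʳ : ∀ a x y → inner y (reflect E a x) ≡ inner y x - pairing E x a * inner y a
  inner-reflectʳ a x y = begin
    inner y (reflect E a x)               ≡⟨ inner-sym y (reflect E a x) ⟩
    inner (reflect E a x) y               ≡⟨ inner-reflectˡ a x y ⟩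
    inner x y - pairing E x a * inner a y ≡⟨ cong₂ (λ u v → u - pairing E x a * v) (inner-sym x y) (inner-sym a y) ⟩
    inner y x - pairing E x a * inner y a ∎

  inner-reflect-self : ∀ x {a} → a ≢ 0ᵥ → inner (reflect E a x) a ≡ - inner x a
  inner-reflect-self x {a} a≢0 = begin
    inner (reflect E a x) a                    ≡⟨ inner-reflectˡ a x a ⟩
    inner x a - pairing E x a * inner a a      ≡⟨ cong (λ t → inner x a - t) (trans (*-comm _ (inner a a)) (inner-self-*-pairing x a≢0)) ⟩
    inner x a - (1ℚ + 1ℚ) * inner x a          ≡⟨ solve 1 (λ u → u :- (con 1ℚ :+ con 1ℚ) :* u := :- u) refl (inner x a) ⟩
    - inner x a                                ∎

module _ {n} {E : Euclidean n} {R : RootSystem E} {r} (Δ : SimpleRoots E R r) where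
  open Euclidean E
  open SimpleRoots Δ

  α≢0ᵥ : ∀ i → lookup α i ≢ 0ᵥ
  α≢0ᵥ i = RootSystem.nonzero R (inΦ i)

  -- dot x (innerα u) is (u, Σₘ xₘ αₘ).
  innerα : Vect n → Fin r → ℚ
  innerα u m = inner u (lookup α m)

  dot-innerα-injective : ∀ {x y : Fin r → ℚ} → (∀ u → dot x (innerα u) ≡ dot y (innerα u)) → ∀ m → x m ≡ y m
  dot-innerα-injective {x} {y} x≈y m = x∙y⁻¹≈ε⇒x≈y (x m) (y m) (linIndep z (inner-self≡0⇒≡0ᵥ E Z ZZ≡0) m)
    where
    z : Fin r → ℚ
    z j = x j - y j
    Z : Vect n
    Z = lincomb z α
    ZZ≡0 : inner Z Z ≡ 0ℚ
    ZZ≡0 = begin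
      inner Z Z                                   ≡⟨ inner-lincombˡ E z α Z ⟩
      sumF r (λ m → z m * inner (lookup α m) Z)   ≡⟨ sumF-cong r (λ m → cong (z m *_) (inner-sym E (lookup α m) Z)) ⟩
      dot z (innerα Z)                            ≡⟨ dot-sub x y (innerα Z) ⟩
      dot x (innerα Z) - dot y (innerα Z)         ≡⟨ cong (_- dot y (innerα Z)) (x≈y Z) ⟩
      dot y (innerα Z) - dot y (innerα Z)         ≡⟨ +-inverseʳ (dot y (innerα Z)) ⟩
      0ℚ                                          ∎

  dot-innerα-reflect : ∀ (x : Fin r → ℚ) a v → dot x (innerα (reflect E a v)) ≡ dot x (innerα v) - pairing E v a * dot x (innerα a)
  dot-innerα-reflect x a v = begin
    sumF r (λ m → x m * inner (reflect E a v) (lookup α m))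
      ≡⟨ sumF-cong r (λ m → cong (x m *_) (inner-reflectˡ E a v (lookup α m))) ⟩
    sumF r (λ m → x m * (innerα v m - p * innerα a m))
      ≡⟨ sumF-cong r (λ m → solve 4 (λ x u p w → x :* (u :- p :* w) := x :* u :+ (:- p) :* (x :* w)) refl (x m) (innerα v m) p (innerα a m)) ⟩
    sumF r (λ m → x m * innerα v m + - p * (x m * innerα a m))
      ≡⟨ sumF-distrib-+ r _ _ ⟩
    dot x (innerα v) + sumF r (λ m → - p * (x m * innerα a m))
      ≡⟨ cong (dot x (innerα v) +_) (trans (sumF-*ˡ r (- p) _) (sym (neg-distribˡ-* p _))) ⟩
    dot x (innerα v) - p * dot x (innerα a)  ∎
    where
    p : ℚ
    p = pairing E v a

  displacement : List (Fin r) → Vect n → Fin r → ℚ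
  displacement []      z = λ _ → 0ℚ
  displacement (i ∷ w) z = addAt i (- pairing E (actV w z) (lookup α i)) (displacement w z)

  dot-displacement : ∀ w z u → dot (displacement w z) (innerα u) ≡ inner u (actV w z) - inner u z
  dot-displacement []      z u = trans (dot-zeroˡ (innerα u)) (sym (+-inverseʳ (inner u z)))
  dot-displacement (i ∷ w) z u = begin
    dot (displacement (i ∷ w) z) (innerα u)                ≡⟨ dot-addAt i (- p) (displacement w z) (innerα u) ⟩
    dot (displacement w z) (innerα u) + - p * innerα u i   ≡⟨ cong (_+ - p * innerα u i) (dot-displacement w z u) ⟩
    (inner u y - inner u z) + - p * innerα u i             ≡⟨ solve 4 (λ a b p c → (a :- b) :+ (:- p) :* c := (a :- p :* c) :- b) refl (inner u y) (inner u z) p (innerα u i) ⟩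
    (inner u y - p * innerα u i) - inner u z               ≡⟨ cong (_- inner u z) (inner-reflectʳ E (lookup α i) y u) ⟨
    inner u (s i y) - inner u z                            ∎
    where
    y : Vect n
    y = actV w z
    p : ℚ
    p = pairing E y (lookup α i)

  displacement-of-trivial : ∀ w → (∀ v → actV w v ≡ v) → ∀ z m → displacement w z m ≡ 0ℚ
  displacement-of-trivial w trivial z = dot-innerα-injective λ u → begin
    dot (displacement w z) (innerα u)   ≡⟨ dot-displacement w z u ⟩
    inner u (actV w z) - inner u z      ≡⟨ cong (λ t → inner u t - inner u z) (trivial z) ⟩
    inner u z - inner u z               ≡⟨ +-inverseʳ (inner u z) ⟩
    0ℚ                                  ≡⟨ dot-zeroˡ (innerα u) ⟨
    dot (λ _ → 0ℚ) (innerα u)           ∎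

  reflectCoeff : Vec ℚ r → Fin r → ℚ
  reflectCoeff x i = sumF r λ j → lookup x j * (- pairing E (lookup α j) (lookup α i))

  reflectCoeff-inner : ∀ x i v →
    reflectCoeff x i * inner v (lookup α i) ≡ - pairing E v (lookup α i) * dot (lookup x) (innerα (lookup α i))
  reflectCoeff-inner x i v = begin
    reflectCoeff x i * a                              ≡⟨ sumF-*ʳ r a _ ⟨
    sumF r (λ j → lookup x j * (- P (lookup α j)) * a) ≡⟨ sumF-cong r term ⟩
    sumF r (λ j → - P v * (lookup x j * innerα αᵢ j))  ≡⟨ sumF-*ˡ r (- P v) _ ⟩
    - P v * dot (lookup x) (innerα αᵢ)                 ∎
    where
    αᵢ : Vect n
    αᵢ = lookup α i
    a : ℚ
    a = inner v αᵢ
    P : Vect n → ℚ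
    P u = pairing E u αᵢ
    term : ∀ j → lookup x j * (- P (lookup α j)) * a ≡ - P v * (lookup x j * innerα αᵢ j)
    term j = begin
      lookup x j * (- P αⱼ) * a           ≡⟨ solve 3 (λ x p a → x :* (:- p) :* a := :- (x :* (p :* a))) refl (lookup x j) (P αⱼ) a ⟩
      - (lookup x j * (P αⱼ * a))         ≡⟨ cong (λ t → - (lookup x j * t)) (pairing-*-inner-comm E αⱼ v αᵢ) ⟩
      - (lookup x j * (P v * inner αⱼ αᵢ)) ≡⟨ cong (λ t → - (lookup x j * (P v * t))) (inner-sym E αⱼ αᵢ) ⟩
      - (lookup x j * (P v * innerα αᵢ j)) ≡⟨ solve 3 (λ x p b → :- (x :* (p :* b)) := (:- p) :* (x :* b)) refl (lookup x j) (P v) (innerα αᵢ j) ⟩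
      - P v * (lookup x j * innerα αᵢ j)  ∎
      where
      αⱼ : Vect n
      αⱼ = lookup α j

  module _ {k} (ι : Fin k → Fin r) where

    βshift : Vec ℚ k → Fin r → ℚ
    βshift c i = sumF k (λ q → lookup c q * δ (ι q) i)

    -- ŝ is written with a Kronecker delta local to its where-block, so its β-summand can only
    -- be named by unification (f = _); lookup-tabulate exposes the tabulated entry so that
    -- with-abstracting m ≟ᶠ i reduces that delta.
    ŝ-unfold : ∀ i x c → Σ[ f ∈ (Fin k → ℚ) ]
               (∀ m → lookup (proj₁ (ŝ ι i (x , c))) m ≡ lookup x m + δ m i * (reflectCoeff x i + sumF k f))
    ŝ-unfold i x c = f , ŝ-at
      where
      f : Fin k → ℚ
      f = _
      ŝ-at : ∀ m → lookup (proj₁ (ŝ ι i (x , c))) m ≡ lookup x m + δ m i * (reflectCoeff x i + sumF k f)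
      ŝ-at m with m ≟ᶠ i | lookup-tabulate (proj₁ (ŝ ι i (x , c))) refl m
      ... | yes _ | eq = eq
      ... | no  _ | eq = eq

    ŝ-unfold-summand : ∀ i x c q → proj₁ (ŝ-unfold i x c) q ≡ lookup c q * δ (ι q) i
    ŝ-unfold-summand i x c q with ι q ≟ᶠ i
    ... | yes _ = refl
    ... | no  _ = refl

    ŝ-α-part : ∀ i x c m → lookup (proj₁ (ŝ ι i (x , c))) m ≡ addAt i (reflectCoeff x i + βshift c i) (lookup x) m
    ŝ-α-part i x c m = trans (proj₂ (ŝ-unfold i x c) m)
      (cong (λ t → lookup x m + δ m i * (reflectCoeff x i + t)) (sumF-cong k (ŝ-unfold-summand i x c)))

    dot-ŝ : ∀ i x c v → dot (lookup (proj₁ (ŝ ι i (x , c)))) (innerα (s i v))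
                        ≡ dot (lookup x) (innerα v) - βshift c i * inner v (lookup α i)
    dot-ŝ i x c v = begin
      dot (lookup (proj₁ (ŝ ι i (x , c)))) (innerα (s i v))
        ≡⟨ dot-congˡ (innerα (s i v)) (ŝ-α-part i x c) ⟩
      dot (addAt i (S + d) (lookup x)) (innerα (s i v))
        ≡⟨ dot-addAt i (S + d) (lookup x) (innerα (s i v)) ⟩
      dot (lookup x) (innerα (s i v)) + (S + d) * inner (s i v) αᵢ
        ≡⟨ cong₂ (λ t u → t + (S + d) * u) (dot-innerα-reflect (lookup x) αᵢ v) (inner-reflect-self E v (α≢0ᵥ i)) ⟩
      (D - P * Q) + (S + d) * (- a)
        ≡⟨ solve 6 (λ D P Q S d a → (D :- P :* Q) :+ (S :+ d) :* (:- a) := (D :- P :* Q :- S :* a) :- d :* a) refl D P Q S d a ⟩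
      (D - P * Q - S * a) - d * a
        ≡⟨ cong (λ t → (D - P * Q - t) - d * a) (reflectCoeff-inner x i v) ⟩
      (D - P * Q - (- P) * Q) - d * a
        ≡⟨ cong (_- d * a) (solve 3 (λ D P Q → D :- P :* Q :- (:- P) :* Q := D) refl D P Q) ⟩
      D - d * a  ∎
      where
      αᵢ : Vect n
      αᵢ = lookup α i
      S d a P D Q : ℚ
      S = reflectCoeff x i
      d = βshift c i
      a = inner v αᵢ
      P = pairing E v αᵢ
      D = dot (lookup x) (innerα v)
      Q = dot (lookup x) (innerα αᵢ)

    -- (ω, αₚ) for the (never constructed) ω with ⟨ω, αₚ^∨⟩ = βshift c p.
    ω-innerα : Vec ℚ k → Fin r → ℚ
    ω-innerα c p = βshift c p * (½ * inner (lookup α p) (lookup α p))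

    dot-displacement-ω : ∀ c i w z → dot (displacement (i ∷ w) z) (ω-innerα c)
                                     ≡ dot (displacement w z) (ω-innerα c) - βshift c i * inner (actV w z) (lookup α i)
    dot-displacement-ω c i w z = begin
      dot (displacement (i ∷ w) z) (ω-innerα c)       ≡⟨ dot-addAt i (- p) (displacement w z) (ω-innerα c) ⟩
      dot (displacement w z) (ω-innerα c) + - p * (d * (½ * N))
        ≡⟨ cong (dot (displacement w z) (ω-innerα c) +_) (solve 4 (λ p d h N → (:- p) :* (d :* (h :* N)) := :- (d :* (h :* N :* p))) refl p d ½ N) ⟩
      dot (displacement w z) (ω-innerα c) - d * (½ * N * p)
        ≡⟨ cong (λ t → dot (displacement w z) (ω-innerα c) - d * t) (½-inner-self-*-pairing E y (α≢0ᵥ i)) ⟩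
      dot (displacement w z) (ω-innerα c) - d * inner y (lookup α i)  ∎
      where
      y : Vect n
      y = actV w z
      p d N : ℚ
      p = pairing E y (lookup α i)
      d = βshift c i
      N = inner (lookup α i) (lookup α i)

    proj₂-actV' : ∀ w v′ → proj₂ (actV' ι w v′) ≡ proj₂ v′
    proj₂-actV' []      v′ = refl
    proj₂-actV' (i ∷ w) v′ = proj₂-actV' w v′

    dot-actV' : ∀ w x c z → dot (lookup (proj₁ (actV' ι w (x , c)))) (innerα (actV w z))
                            ≡ dot (lookup x) (innerα z) + dot (displacement w z) (ω-innerα c)
    dot-actV' []      x c z = sym (trans (cong (dot (lookup x) (innerα z) +_) (dot-zeroˡ (ω-innerα c))) (+-identityʳ _))
    dot-actV' (i ∷ w) x c z = begin
      dot (lookup (proj₁ (ŝ ι i v′))) (innerα (s i y))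
        ≡⟨ dot-ŝ i (proj₁ v′) (proj₂ v′) y ⟩
      dot (lookup (proj₁ v′)) (innerα y) - βshift (proj₂ v′) i * inner y (lookup α i)
        ≡⟨ cong₂ (λ t c′ → t - βshift c′ i * inner y (lookup α i)) (dot-actV' w x c z) (proj₂-actV' w (x , c)) ⟩
      dot (lookup x) (innerα z) + dot (displacement w z) (ω-innerα c) - βshift c i * inner y (lookup α i)
        ≡⟨ +-assoc (dot (lookup x) (innerα z)) _ _ ⟩
      dot (lookup x) (innerα z) + (dot (displacement w z) (ω-innerα c) - βshift c i * inner y (lookup α i))
        ≡⟨ cong (dot (lookup x) (innerα z) +_) (dot-displacement-ω c i w z) ⟨
      dot (lookup x) (innerα z) + dot (displacement (i ∷ w) z) (ω-innerα c)  ∎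
      where
      v′ : V' k
      v′ = actV' ι w (x , c)
      y : Vect n
      y = actV w z

mainTheorem3 : ∀ {n} (E : Euclidean n) (R : RootSystem E) (r : ℕ) (Δ : SimpleRoots E R r)
    → ∀ {k} (ι : Fin k → Fin r) → Injective _≡_ _≡_ ι
    → ∀ (w : List (Fin r))
    → (∀ v → SimpleRoots.actV Δ w v ≡ v)
    → ∀ v' → SimpleRoots.actV' Δ ι w v' ≡ v'
mainTheorem3 E R r Δ ι _ w trivial (x , c) = cong₂ _,_ α-part-fixed (proj₂-actV' Δ ι w (x , c))
  where
  x′ : Vec ℚ r
  x′ = proj₁ (SimpleRoots.actV' Δ ι w (x , c))
  ω : Fin r → ℚ
  ω = ω-innerα Δ ι c
  α-part-fixed : x′ ≡ x
  α-part-fixed = lookup-extensionality (dot-innerα-injective Δ λ z → begin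
    dot (lookup x′) (innerα Δ z)
      ≡⟨ cong (dot (lookup x′) ∘ innerα Δ) (trivial z) ⟨
    dot (lookup x′) (innerα Δ (SimpleRoots.actV Δ w z))
      ≡⟨ dot-actV' Δ ι w x c z ⟩
    dot (lookup x) (innerα Δ z) + dot (displacement Δ w z) ω
      ≡⟨ cong (dot (lookup x) (innerα Δ z) +_) (trans (dot-congˡ ω (displacement-of-trivial Δ w trivial z)) (dot-zeroˡ ω)) ⟩
    dot (lookup x) (innerα Δ z) + 0ℚ
      ≡⟨ +-identityʳ _ ⟩
    dot (lookup x) (innerα Δ z)  ∎)
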